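{- For all $r,n\ge0$ there is a bijection $(w_0,v_1,\dots,v_k)\mapsto(w_0,u_1,\dots,u_h)$ from $V_n^*(r)$ onto $U_n^*(r)$ (preserving the first component $w_0$) such that (i) $u_1u_2\cdots u_h$ is a rearrangement of $v_1v_2\cdots v_k$, so that $\mathrm{tot}\,u_1+\cdots+\mathrm{tot}\,u_h=\mathrm{tot}\,v_1+\cdots+\mathrm{tot}\,v_k$; and (ii) $\mathrm{dec}\,u_1+\cdots+\mathrm{dec}\,u_h=\mathrm{dec}\,v_1+\cdots+\mathrm{dec}\,v_k$.
   Context: Words have nonnegative integer letters; $\lambda$ is length, $\mathrm{tot}$ is the sum of letters, $\max$ the maximum letter. For $w=x_1\cdots x_n$, $i\in\{1,\dots,n-1\}$ is a decrease if $x_i\ge\cdots\ge x_j>x_{j+1}$ for some $i\le j\le n-1$; $\mathrm{dec}\,w$ counts them. A $V$-word (resp. $U$-word) is a word $x_1\cdots x_n$, $n\ge2$, such that for some $1\le i\le n-1$: $x_1\ge\cdots\ge x_i>x_{i+1}$ and $x_{i+1}\le\cdots\le x_n<x_i$ (resp. $x_{i+1}\le\cdots\le x_n<x_1$); for such a word $\mathrm{rmin}$ denotes the letter $x_{i+1}$. $\mathrm{NIW}(r)$ is the set of nonincreasing words with letters in $\{0,\dots,r\}$. $V_n^*(r)$ is the set of sequences $(w_0,w_1,\dots,w_k)$, $k\ge0$, with $w_0\in\mathrm{NIW}(r)$, each $w_j$ ($1\le j\le k$) a $V$-word with letters $\le r$, and $\lambda w_0+\cdots+\lambda w_k=n$.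 $U_n^*(r)$ is the set of such sequences where each $w_j$ ($j\ge1$) is a $U$-word with letters $\le r$ and moreover $\mathrm{rmin}\,w_j<\max w_{j+1}$ for $1\le j\le k-1$. -}

module Defs where

open import Data.Nat using (ℕ; zero; suc; _+_; _≤_; _<_; _>_; _⊔_; _≟_; _<?_)
open import Data.List using (List; []; _∷_; _++_; map; length; concat; foldr)
open import Data.Nat.ListAction using (sum)
open import Data.List.Relation.Unary.All using (All)
open import Data.List.Relation.Binary.Permutation.Propositional using (_↭_)
open import Data.Product using (Σ; _×_; _,_; ∃)
open import Data.Unit using (⊤)
open import Data.Empty using (⊥)
open import Relation.Binary.PropositionalEquality using (_≡_)
open import Relation.Nullary using (yes; no; Dec)

Word : Set
Word = List ℕ

len : Word → ℕ
len = length

tot : Word → ℕ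
tot = sum

-- max w (0 for the empty word; only used on nonempty words)
maxL : Word → ℕ
maxL = foldr _⊔_ 0

data NonIncr : Word → Set where
  ni[]  : NonIncr []
  ni[_] : ∀ x → NonIncr (x ∷ [])
  ni∷   : ∀ {x y w} → y ≤ x → NonIncr (y ∷ w) → NonIncr (x ∷ y ∷ w)

data NonDecr : Word → Set where
  nd[]  : NonDecr []
  nd[_] : ∀ x → NonDecr (x ∷ [])
  nd∷   : ∀ {x y w} → x ≤ y → NonDecr (y ∷ w) → NonDecr (x ∷ y ∷ w)

Bounded : ℕ → Word → Set
Bounded r w = All (λ x → x ≤ r) w

-- isDecrease (x_i ∷ x_{i+1} ∷ ⋯ ∷ x_n) = 1 if i is a decrease, i.e.
-- x_i ≥ ⋯ ≥ x_j > x_{j+1} for some j ≥ i (unfolded by recursion on j), else 0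
isDecrease : Word → ℕ
isDecrease [] = 0
isDecrease (x ∷ []) = 0
isDecrease (x ∷ y ∷ w) = step (y <? x) (x ≟ y) (isDecrease (y ∷ w))
  where
  step : ∀ {p q : Set} → Dec p → Dec q → ℕ → ℕ
  step (yes _) _ _ = 1
  step (no _) (yes _) k = k
  step (no _) (no _) _ = 0

dec : Word → ℕ
dec [] = 0
dec (x ∷ w) = isDecrease (x ∷ w) + dec w

-- a split witness w = (x_1 ⋯ x_i) ++ (x_{i+1} ⋯ x_n) with a = x_1⋯x_i
-- nonempty nonincreasing, b = x_{i+1}⋯x_n nonempty nondecreasing, x_i > x_{i+1};
-- the first letter of a, the last letter of a, and rmin = x_{i+1} are exposed.
record Split (w : Word) : Set where
  constructor split
  field
    a b        : Word
    first lastA rmin : ℕ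
    aTail bTail : Word
    a≡   : a ≡ first ∷ aTail
    lastA≡ : ∃ λ c → a ≡ c ++ (lastA ∷ [])
    b≡   : b ≡ rmin ∷ bTail
    w≡   : w ≡ a ++ b
    aNI  : NonIncr a
    bND  : NonDecr b
    drop : rmin < lastA

-- V-word: additionally x_n < x_i ; U-word: additionally x_n < x_1
record VSplit (w : Word) : Set where
  field
    sp : Split w
    lastB : ℕ
    lastB≡ : ∃ λ c → Split.b sp ≡ c ++ (lastB ∷ [])
    cond : lastB < Split.lastA sp

record USplit (w : Word) : Set where
  field
    sp : Split w
    lastB : ℕ
    lastB≡ : ∃ λ c → Split.b sp ≡ c ++ (lastB ∷ [])
    cond : lastB < Split.first sp

VWord : Word → Set
VWord w = VSplit w

UWord : Word → Set
UWord w = USplit w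

data Chain : List Word → Set where
  c[]  : Chain []
  c[_] : ∀ w → Chain (w ∷ [])
  c∷   : ∀ {u v ws} → (∃ λ (s : USplit u) → Split.rmin (USplit.sp s) < maxL v) →
         Chain (v ∷ ws) → Chain (u ∷ v ∷ ws)

-- an element (w_0, w_1, …, w_k) is represented as a pair (w_0 , [w_1, …, w_k])
Seq : Set
Seq = Word × List Word

totalLen : Seq → ℕ
totalLen (w0 , ws) = len w0 + sum (map len ws)

InV : ℕ → ℕ → Seq → Set
InV r n (w0 , ws) =
  NonIncr w0 × Bounded r w0 × All (λ w → VWord w × Bounded r w) ws × totalLen (w0 , ws) ≡ n

InU : ℕ → ℕ → Seq → Set
InU r n (w0 , ws) =
  NonIncr w0 × Bounded r w0 × All (λ w → UWord w × Bounded r w) ws × Chain ws ×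
  totalLen (w0 , ws) ≡ n

Compatible : Seq → Seq → Set
Compatible (w0 , vs) (w0' , us) =
  w0' ≡ w0 × concat us ↭ concat vs × sum (map dec us) ≡ sum (map dec vs)

-- A V- or U-word is a valley a ++ b (a nonincreasing, b nondecreasing, head b < last a),
-- and its decreases are exactly the positions of a, so dec (a ++ b) = length a.  Every U-word
-- is uniquely a nest a₁ a₂ ⋯ aₖ bₖ ⋯ b₂ b₁ of V-words aⱼ ++ bⱼ, where the maximum of each
-- inner part aⱼ₊₁ ⋯ bⱼ₊₁ is at most rmin (aⱼ ++ bⱼ) = head bⱼ.  Reading a list of V-words
-- from the right, φ nests each V-word around the following U-word exactly when the chain
-- condition rmin < max would fail, and ψ takes every U-word apart into its nest.  Nesting
-- only rearranges letters and adds up the lengths of the descending parts, so tot and dec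
-- are preserved.

module Submission where

open import Defs
open import Data.Nat using (ℕ; zero; suc; _+_; _≤_; _<_; _≤?_; _<?_; _≟_; z≤n; s≤s)
open import Data.Product using (Σ; _×_; ∃; ∃₂; _,_; proj₁; proj₂; map₁)
open import Relation.Binary.PropositionalEquality
  using (_≡_; refl; sym; trans; cong; cong₂; subst; subst₂; module ≡-Reasoning)
open import Data.Bool using (if_then_else_)
open import Data.Empty using (⊥; ⊥-elim)
open import Data.List using (List; []; _∷_; _++_; map; length; concat; concatMap; foldr; takeWhile; dropWhile)
open import Data.List.Properties
  using (++-assoc; ++-identityʳ; length-++; length-++-≤ˡ; length-++-≤ʳ; foldr-++; concat-++; map-++)
open import Data.List.Relation.Unary.All using (All; []; _∷_)
import Data.List.Relation.Unary.All as All
import Data.List.Relation.Unary.All.Properties as All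
open import Data.List.Relation.Binary.Permutation.Propositional
  using (_↭_; ↭-refl; ↭-trans; ↭-reflexive; ↭-sym; module PermutationReasoning)
import Data.List.Relation.Binary.Permutation.Propositional.Properties as ↭
open import Data.Nat.Properties
open import Data.Nat.ListAction using (sum)
open import Data.Nat.ListAction.Properties using (sum-++)
open import Data.Unit using (⊤; tt)
open import Function using (_∘_)
open import Relation.Nullary using (¬_; Dec; yes; no; does; contradiction)
open import Relation.Nullary.Decidable using (dec-true; dec-false; _×-dec_; map′)
open import Relation.Unary using (Decidable)

variable
  a b c d u w : Word
  us vs ws : List Word
  x y : ℕ

-- Junk value 0 on the empty word; the lemmas about them assume NonEmpty.
head₀ : Word → ℕ
head₀ [] = 0
head₀ (x ∷ _) = x

last₀ : Word → ℕ
last₀ [] = 0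
last₀ (x ∷ []) = x
last₀ (_ ∷ y ∷ w) = last₀ (y ∷ w)

NonEmpty : Word → Set
NonEmpty [] = ⊥
NonEmpty (_ ∷ _) = ⊤

head₀-++ : NonEmpty a → head₀ (a ++ b) ≡ head₀ a
head₀-++ {_ ∷ _} _ = refl

last₀-++ : ∀ a → NonEmpty b → last₀ (a ++ b) ≡ last₀ b
last₀-++ [] _ = refl
last₀-++ {_ ∷ _} (_ ∷ []) _ = refl
last₀-++ (_ ∷ y ∷ a) ne = last₀-++ (y ∷ a) ne

last₀-snoc : (∃ λ c → w ≡ c ++ x ∷ []) → last₀ w ≡ x
last₀-snoc {x = x} (c , refl) = last₀-++ {b = x ∷ []} c tt

snoc-last₀ : ∀ x w → ∃ λ c → x ∷ w ≡ c ++ last₀ (x ∷ w) ∷ []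
snoc-last₀ x [] = [] , refl
snoc-last₀ x (y ∷ w) = let c , eq = snoc-last₀ y w in x ∷ c , cong (x ∷_) eq

All-last₀ : {P : ℕ → Set} → NonEmpty a → All P a → P (last₀ a)
All-last₀ {_ ∷ []} _ (p ∷ []) = p
All-last₀ {_ ∷ _ ∷ _} _ (_ ∷ ps) = All-last₀ tt ps

length-<-++ : NonEmpty a → length c < length (a ++ c)
length-<-++ {_ ∷ a} {c} _ = s≤s (length-++-≤ʳ c {a})

++-regroup : ∀ (a c d b : Word) → a ++ (c ++ d) ++ b ≡ (a ++ c) ++ (d ++ b)
++-regroup a c d b = trans (cong (a ++_) (++-assoc c d b)) (sym (++-assoc a c (d ++ b)))

takeWhile-++-∷ : ∀ {P : ℕ → Set} (P? : Decidable P) → All P a → ¬ P y →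
                 takeWhile P? (a ++ y ∷ b) ≡ a
takeWhile-++-∷ P? [] ¬py rewrite dec-false (P? _) ¬py = refl
takeWhile-++-∷ P? (px ∷ pa) ¬py rewrite dec-true (P? _) px =
  cong (_ ∷_) (takeWhile-++-∷ P? pa ¬py)

dropWhile-++-∷ : ∀ {P : ℕ → Set} (P? : Decidable P) → All P a → ¬ P y →
                 dropWhile P? (a ++ y ∷ b) ≡ y ∷ b
dropWhile-++-∷ P? [] ¬py rewrite dec-false (P? _) ¬py = refl
dropWhile-++-∷ P? (px ∷ pa) ¬py rewrite dec-true (P? _) px = dropWhile-++-∷ P? pa ¬py

length-concat : ∀ {A : Set} (xss : List (List A)) → length (concat xss) ≡ sum (map length xss)
length-concat [] = refl
length-concat (xs ∷ xss) = trans (length-++ xs) (cong (length xs +_) (length-concat xss))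

sum-length-↭ : ∀ {A : Set} (xss yss : List (List A)) →
               concat xss ↭ concat yss → sum (map length xss) ≡ sum (map length yss)
sum-length-↭ xss yss p =
  trans (sym (length-concat xss)) (trans (↭.↭-length p) (length-concat yss))

All-concat-↭ : ∀ {A : Set} {P : A → Set} {xss yss : List (List A)} →
               concat xss ↭ concat yss → All (All P) xss → All (All P) yss
All-concat-↭ p = All.concat⁻ ∘ ↭.All-resp-↭ p ∘ All.concat⁺

maxL≤ : ∀ {m} → All (_≤ m) w → maxL w ≤ m
maxL≤ [] = z≤n
maxL≤ (p ∷ ps) = ⊔-lub p (maxL≤ ps)

head₀≤maxL : ∀ w → head₀ w ≤ maxL w
head₀≤maxL [] = z≤n
head₀≤maxL (x ∷ w) = m≤m⊔n x (maxL w)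

-- Monotone words

nonIncr-++ : NonIncr a → NonIncr (y ∷ b) → y ≤ last₀ a → NonIncr (a ++ y ∷ b)
nonIncr-++ ni[] q _ = q
nonIncr-++ ni[ _ ] q y≤x = ni∷ y≤x q
nonIncr-++ (ni∷ le p) q y≤ = ni∷ le (nonIncr-++ p q y≤)

nonDecr-++ : NonDecr a → NonDecr (y ∷ b) → last₀ a ≤ y → NonDecr (a ++ y ∷ b)
nonDecr-++ nd[] q _ = q
nonDecr-++ nd[ _ ] q x≤y = nd∷ x≤y q
nonDecr-++ (nd∷ le p) q ≤y = nd∷ le (nonDecr-++ p q ≤y)

nonIncr-++⁻ˡ : ∀ a → NonIncr (a ++ b) → NonIncr a
nonIncr-++⁻ˡ [] _ = ni[]
nonIncr-++⁻ˡ (x ∷ []) _ = ni[ x ]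
nonIncr-++⁻ˡ (_ ∷ y ∷ a) (ni∷ le p) = ni∷ le (nonIncr-++⁻ˡ (y ∷ a) p)

nonIncr-++⁻ʳ : ∀ a → NonIncr (a ++ b) → NonIncr b
nonIncr-++⁻ʳ [] p = p
nonIncr-++⁻ʳ {[]} (_ ∷ []) _ = ni[]
nonIncr-++⁻ʳ {_ ∷ _} (_ ∷ []) (ni∷ _ p) = p
nonIncr-++⁻ʳ (_ ∷ y ∷ a) (ni∷ _ p) = nonIncr-++⁻ʳ (y ∷ a) p

nonDecr-++⁻ˡ : ∀ a → NonDecr (a ++ b) → NonDecr a
nonDecr-++⁻ˡ [] _ = nd[]
nonDecr-++⁻ˡ (x ∷ []) _ = nd[ x ]
nonDecr-++⁻ˡ (_ ∷ y ∷ a) (nd∷ le p) = nd∷ le (nonDecr-++⁻ˡ (y ∷ a) p)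

nonDecr-++⁻ʳ : ∀ a → NonDecr (a ++ b) → NonDecr b
nonDecr-++⁻ʳ [] p = p
nonDecr-++⁻ʳ {[]} (_ ∷ []) _ = nd[]
nonDecr-++⁻ʳ {_ ∷ _} (_ ∷ []) (nd∷ _ p) = p
nonDecr-++⁻ʳ (_ ∷ y ∷ a) (nd∷ _ p) = nonDecr-++⁻ʳ (y ∷ a) p

nonIncr-≤head₀ : NonIncr a → All (_≤ head₀ a) a
nonIncr-≤head₀ ni[] = []
nonIncr-≤head₀ ni[ _ ] = ≤-refl ∷ []
nonIncr-≤head₀ (ni∷ y≤x p) = ≤-refl ∷ All.map (λ z≤y → ≤-trans z≤y y≤x) (nonIncr-≤head₀ p)

nonDecr-head₀≤ : NonDecr a → All (head₀ a ≤_) a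
nonDecr-head₀≤ nd[] = []
nonDecr-head₀≤ nd[ _ ] = ≤-refl ∷ []
nonDecr-head₀≤ (nd∷ x≤y p) = ≤-refl ∷ All.map (≤-trans x≤y) (nonDecr-head₀≤ p)

nonIncr-last₀≤ : NonIncr a → All (last₀ a ≤_) a
nonIncr-last₀≤ ni[] = []
nonIncr-last₀≤ ni[ _ ] = ≤-refl ∷ []
nonIncr-last₀≤ (ni∷ y≤x p) with nonIncr-last₀≤ p
... | l≤y ∷ l≤ = ≤-trans l≤y y≤x ∷ l≤y ∷ l≤

nonDecr-≤last₀ : NonDecr a → All (_≤ last₀ a) a
nonDecr-≤last₀ nd[] = []
nonDecr-≤last₀ nd[ _ ] = ≤-refl ∷ []
nonDecr-≤last₀ (nd∷ x≤y p) with nonDecr-≤last₀ p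
... | y≤l ∷ ≤l = ≤-trans x≤y y≤l ∷ y≤l ∷ ≤l

last₀≤head₀ : NonIncr a → NonEmpty a → last₀ a ≤ head₀ a
last₀≤head₀ ni ne = All-last₀ ne (nonIncr-≤head₀ ni)

head₀≤last₀ : NonDecr a → NonEmpty a → head₀ a ≤ last₀ a
head₀≤last₀ nd ne = All-last₀ ne (nonDecr-head₀≤ nd)

nonIncr-cut : ∀ t → NonIncr c → ∃₂ λ c₁ c₂ → c ≡ c₁ ++ c₂ × All (t <_) c₁ × All (_≤ t) c₂
nonIncr-cut t ni[] = [] , [] , refl , [] , []
nonIncr-cut {x ∷ c} t p with t <? x | p
... | no x≯t | _ =
  [] , x ∷ c , refl , [] , All.map (λ z≤x → ≤-trans z≤x (≮⇒≥ x≯t)) (nonIncr-≤head₀ p)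
... | yes t<x | ni[ _ ] = x ∷ [] , [] , refl , t<x ∷ [] , []
... | yes t<x | ni∷ _ q = let c₁ , c₂ , eq , above , below = nonIncr-cut t q in
                           x ∷ c₁ , c₂ , cong (x ∷_) eq , t<x ∷ above , below

nonDecr-cut : ∀ t → NonDecr d → ∃₂ λ d₁ d₂ → d ≡ d₁ ++ d₂ × All (_< t) d₁ × All (t ≤_) d₂
nonDecr-cut t nd[] = [] , [] , refl , [] , []
nonDecr-cut {x ∷ d} t p with x <? t | p
... | no x≮t | _ =
  [] , x ∷ d , refl , [] , All.map (≤-trans (≮⇒≥ x≮t)) (nonDecr-head₀≤ p)
... | yes x<t | nd[ _ ] = x ∷ [] , [] , refl , x<t ∷ [] , []
... | yes x<t | nd∷ _ q = let d₁ , d₂ , eq , below , above = nonDecr-cut t q in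
                           x ∷ d₁ , d₂ , cong (x ∷_) eq , x<t ∷ below , above

-- Valleys

-- Valley a b is the paper's factorisation x₁⋯xᵢ | xᵢ₊₁⋯xₙ, with rmin = head₀ b;
-- VValley and UValley add the conditions xₙ < xᵢ and xₙ < x₁.
record Valley (a b : Word) : Set where
  constructor mkValley
  field
    nonIncrˡ  : NonIncr a
    nonDecrʳ  : NonDecr b
    nonEmptyˡ : NonEmpty a
    nonEmptyʳ : NonEmpty b
    descent   : head₀ b < last₀ a
open Valley

VValley UValley : Word → Word → Set
VValley a b = Valley a b × last₀ b < last₀ a
UValley a b = Valley a b × last₀ b < head₀ a

Valley-tail : Valley (x ∷ y ∷ a) b → Valley (y ∷ a) b
Valley-tail (mkValley (ni∷ _ ni) nd _ ne lt) = mkValley ni nd tt ne lt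

VValley-above : VValley a b → All (last₀ b <_) a
VValley-above (v , lt) = All.map (<-≤-trans lt) (nonIncr-last₀≤ (nonIncrˡ v))

UValley-below : UValley a b → All (_< head₀ a) b
UValley-below (v , lt) = All.map (λ z≤l → ≤-<-trans z≤l lt) (nonDecr-≤last₀ (nonDecrʳ v))

VValley⇒UValley : VValley a b → UValley a b
VValley⇒UValley (v , lt) = v , <-≤-trans lt (last₀≤head₀ (nonIncrˡ v) (nonEmptyˡ v))

maxL-UValley : UValley a b → maxL (a ++ b) ≡ head₀ a
maxL-UValley {a} {b} (v , lt) = ≤-antisym
  (maxL≤ (All.++⁺ (nonIncr-≤head₀ (nonIncrˡ v))
                  (All.map (λ z≤l → ≤-trans z≤l (<⇒≤ lt)) (nonDecr-≤last₀ (nonDecrʳ v)))))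
  (subst (_≤ maxL (a ++ b)) (head₀-++ (nonEmptyˡ v)) (head₀≤maxL (a ++ b)))

Split⇒Valley : (s : Split w) →
               Valley (Split.a s) (Split.b s) × last₀ (Split.a s) ≡ Split.lastA s
Split⇒Valley (split _ _ _ _ rmin _ _ refl lastA≡ refl _ ni nd drop) =
  mkValley ni nd tt tt (subst (rmin <_) (sym (last₀-snoc lastA≡)) drop) , last₀-snoc lastA≡

VWord⇒VValley : VWord w → ∃₂ λ a b → w ≡ a ++ b × VValley a b
VWord⇒VValley record { sp = s ; lastB≡ = lastB≡ ; cond = cond } =
  let v , lastA≡ = Split⇒Valley s in
  _ , _ , Split.w≡ s , v , subst₂ _<_ (sym (last₀-snoc lastB≡)) (sym lastA≡) cond

UWord⇒UValley : (u : UWord w) →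
                ∃₂ λ a b → w ≡ a ++ b × UValley a b × head₀ b ≡ Split.rmin (USplit.sp u)
UWord⇒UValley record { sp = s ; lastB≡ = lastB≡ ; cond = cond } =
  _ , _ , Split.w≡ s ,
  (proj₁ (Split⇒Valley s) ,
   subst₂ _<_ (sym (last₀-snoc lastB≡)) (sym (cong head₀ (Split.a≡ s))) cond) ,
  cong head₀ (Split.b≡ s)

Valley⇒Split : Valley a b → Split (a ++ b)
Valley⇒Split {x ∷ a} {y ∷ b} (mkValley ni nd _ _ lt) =
  split (x ∷ a) (y ∷ b) x (last₀ (x ∷ a)) y a b refl (snoc-last₀ x a) refl refl ni nd lt

VValley⇒VWord : VValley a b → VWord (a ++ b)
VValley⇒VWord {x ∷ _} {y ∷ b} (v , lt) =
  record { sp = Valley⇒Split v ; lastB = last₀ (y ∷ b) ; lastB≡ = snoc-last₀ y b ; cond = lt }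

UValley⇒UWord : UValley a b → UWord (a ++ b)
UValley⇒UWord {x ∷ _} {y ∷ b} (v , lt) =
  record { sp = Valley⇒Split v ; lastB = last₀ (y ∷ b) ; lastB≡ = snoc-last₀ y b ; cond = lt }

rmin-UValley⇒UWord : (u : UValley a b) → Split.rmin (USplit.sp (UValley⇒UWord u)) ≡ head₀ b
rmin-UValley⇒UWord {_ ∷ _} {_ ∷ _} _ = refl

maxL-UWord : UWord u → maxL u ≡ head₀ u
maxL-UWord u with UWord⇒UValley u
... | _ , _ , refl , (v , lt) , _ = trans (maxL-UValley (v , lt)) (sym (head₀-++ (nonEmptyˡ v)))

nonDecr? : (w : Word) → Dec (NonDecr w)
nonDecr? [] = yes nd[]
nonDecr? (x ∷ []) = yes nd[ x ]
nonDecr? (x ∷ y ∷ w) =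
  map′ (λ (x≤y , nd) → nd∷ x≤y nd) (λ { (nd∷ x≤y nd) → x≤y , nd }) (x ≤? y ×-dec nonDecr? (y ∷ w))

splitValley : Word → Word × Word
splitValley [] = [] , []
splitValley (x ∷ w) =
  if does (head₀ w <? x ×-dec nonDecr? w) then (x ∷ [] , w) else map₁ (x ∷_) (splitValley w)

¬nonDecr-descent : ∀ a → NonEmpty b → head₀ b < last₀ a → ¬ NonDecr (a ++ b)
¬nonDecr-descent [] _ ()
¬nonDecr-descent {_ ∷ _} (_ ∷ []) _ y<x (nd∷ x≤y _) = <⇒≱ y<x x≤y
¬nonDecr-descent (_ ∷ y ∷ a) ne lt (nd∷ _ nd) = ¬nonDecr-descent (y ∷ a) ne lt nd

splitValley-++ : Valley a b → splitValley (a ++ b) ≡ (a , b)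
splitValley-++ {x ∷ []} {b} v
  rewrite dec-true (head₀ b <? x ×-dec nonDecr? b) (descent v , nonDecrʳ v) = refl
splitValley-++ {x ∷ y ∷ a} {b} v =
  trans (cong (λ p → if p then (x ∷ [] , y ∷ a ++ b)
                           else map₁ (x ∷_) (splitValley (y ∷ a ++ b)))
              (dec-false (head₀ (y ∷ a ++ b) <? x ×-dec nonDecr? (y ∷ a ++ b))
                         (¬nonDecr-descent (y ∷ a) (nonEmptyʳ v) (descent v) ∘ proj₂)))
        (cong (map₁ (x ∷_)) (splitValley-++ (Valley-tail v)))

Valley-unique : Valley a b → Valley c d → a ++ b ≡ c ++ d → b ≡ d
Valley-unique v v′ eq =
  cong proj₂ (trans (sym (splitValley-++ v)) (trans (cong splitValley eq) (splitValley-++ v′)))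

rmin-unique : UValley c d → (s : UWord (c ++ d)) → head₀ d ≡ Split.rmin (USplit.sp s)
rmin-unique (v , _) s with UWord⇒UValley s
... | _ , _ , eq , (v′ , _) , rmin≡ = trans (cong head₀ (Valley-unique v v′ eq)) rmin≡

isDecrease-descent : NonIncr a → NonEmpty b → head₀ b < last₀ a → isDecrease (a ++ b) ≡ 1
isDecrease-descent {x ∷ []} {y ∷ _} _ _ y<x with y <? x
... | yes _ = refl
... | no y≮x = contradiction y<x y≮x
isDecrease-descent {x ∷ y ∷ a} (ni∷ y≤x ni) ne lt with y <? x
... | yes _ = refl
... | no y≮x with x ≟ y
...   | yes _ = isDecrease-descent ni ne lt
...   | no x≢y = contradiction (≤∧≢⇒< y≤x (x≢y ∘ sym)) y≮x

isDecrease-nonDecr : NonDecr b → isDecrease b ≡ 0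
isDecrease-nonDecr nd[] = refl
isDecrease-nonDecr nd[ _ ] = refl
isDecrease-nonDecr (nd∷ {x} {y} x≤y nd) with y <? x
... | yes y<x = contradiction x≤y (<⇒≱ y<x)
... | no _ with x ≟ y
...   | yes _ = isDecrease-nonDecr nd
...   | no _ = refl

dec-nonDecr : NonDecr b → dec b ≡ 0
dec-nonDecr nd[] = refl
dec-nonDecr nd[ _ ] = refl
dec-nonDecr (nd∷ x≤y nd) = cong₂ _+_ (isDecrease-nonDecr (nd∷ x≤y nd)) (dec-nonDecr nd)

dec-Valley : Valley a b → dec (a ++ b) ≡ length a
dec-Valley {_ ∷ []} v =
  cong₂ _+_ (isDecrease-descent (nonIncrˡ v) (nonEmptyʳ v) (descent v)) (dec-nonDecr (nonDecrʳ v))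
dec-Valley {_ ∷ _ ∷ _} v =
  cong₂ _+_ (isDecrease-descent (nonIncrˡ v) (nonEmptyʳ v) (descent v)) (dec-Valley (Valley-tail v))

-- Nests of V-words

nest-UValley : VValley a b → UValley c d → head₀ c ≤ head₀ b → UValley (a ++ c) (d ++ b)
nest-UValley {x ∷ a} {y ∷ b} {z ∷ c} {w ∷ d} (v , v-last) (u , u-last) z≤y =
  mkValley (nonIncr-++ (nonIncrˡ v) (nonIncrˡ u) (≤-trans z≤y (<⇒≤ (descent v))))
           (nonDecr-++ (nonDecrʳ u) (nonDecrʳ v) (≤-trans (<⇒≤ u-last) z≤y))
           tt tt
           (subst (w <_) (sym (last₀-++ (x ∷ a) tt)) (descent u))
  , subst (_< x) (sym (last₀-++ (w ∷ d) tt)) (<-≤-trans v-last (last₀≤head₀ (nonIncrˡ v) tt))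

-- Nest c d ws: c = a₁ ⋯ aₖ and d = bₖ ⋯ b₁ for ws = (a₁ ++ b₁) ∷ ⋯ ∷ (aₖ ++ bₖ).
data Nest : Word → Word → List Word → Set where
  single : VValley a b → Nest a b ((a ++ b) ∷ [])
  nest   : VValley a b → Nest c d ws → head₀ c ≤ head₀ b → Nest (a ++ c) (d ++ b) ((a ++ b) ∷ ws)

Nest⇒UValley : Nest c d ws → UValley c d
Nest⇒UValley (single v) = VValley⇒UValley v
Nest⇒UValley (nest v N le) = nest-UValley v (Nest⇒UValley N) le

Nest⇒VWords : Nest c d ws → All VWord ws
Nest⇒VWords (single v) = VValley⇒VWord v ∷ []
Nest⇒VWords (nest v N _) = VValley⇒VWord v ∷ Nest⇒VWords N

head₀-Nestˡ : Nest c d ws → head₀ (c ++ w) ≡ head₀ c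
head₀-Nestˡ N = head₀-++ (nonEmptyˡ (proj₁ (Nest⇒UValley N)))

head₀-Nestʳ : Nest c d ws → head₀ (d ++ w) ≡ head₀ d
head₀-Nestʳ N = head₀-++ (nonEmptyʳ (proj₁ (Nest⇒UValley N)))

Nest-length : Nest c d ws → length ws ≤ length c
Nest-length (nest (v , _) N _) = <-≤-trans (s≤s (Nest-length N)) (length-<-++ (nonEmptyˡ v))
Nest-length (single {_ ∷ _} _) = s≤s z≤n

Nest-↭ : Nest c d ws → c ++ d ↭ concat ws
Nest-↭ (single {a} {b} _) = ↭-reflexive (sym (++-identityʳ (a ++ b)))
Nest-↭ (nest {a} {b} {c} {d} {ws} _ N _) = begin
  (a ++ c) ++ (d ++ b)  ≡⟨ ++-assoc a c (d ++ b) ⟩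
  a ++ c ++ d ++ b      ≡⟨ cong (a ++_) (sym (++-assoc c d b)) ⟩
  a ++ (c ++ d) ++ b    ↭⟨ ↭.++⁺ˡ a (↭.++-comm (c ++ d) b) ⟩
  a ++ b ++ c ++ d      ↭⟨ ↭.++⁺ˡ a (↭.++⁺ˡ b (Nest-↭ N)) ⟩
  a ++ b ++ concat ws   ≡⟨ sym (++-assoc a b (concat ws)) ⟩
  (a ++ b) ++ concat ws ∎
  where open PermutationReasoning

Nest-dec : Nest c d ws → sum (map dec ws) ≡ length c
Nest-dec (single (v , _)) = trans (+-identityʳ _) (dec-Valley v)
Nest-dec (nest {a} {c = c} (v , _) N _) =
  trans (cong₂ _+_ (dec-Valley v) (Nest-dec N)) (sym (length-++ a {c}))

-- The outermost V-word of a U-word c ++ d that is not itself a V-word consists of the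
-- letters of c above last₀ d and the letters of d from h on, h being the first letter
-- of c not above last₀ d.
data Peeled : Word → Word → Set where
  outer : VValley c d → Peeled c d
  inner : VValley a b → UValley c d → head₀ c ≤ head₀ b → Peeled (a ++ c) (d ++ b)

peel : UValley c d → Peeled c d
peel {d = d} (v , d<c) with nonIncr-cut (last₀ d) (nonIncrˡ v)
... | c₁ , [] , refl , above , _ = outer (v , All-last₀ (nonEmptyˡ v) (All.++⁺ above []))
... | c₁ , h ∷ c₂ , refl , above , h≤ ∷ _ with nonDecr-cut h (nonDecrʳ v)
...   | d₁ , d₂ , refl , below , over = peel-cut c₁ d₁ d₂ (v , d<c) above h≤ below over
  where
  peel-cut : ∀ c₁ d₁ d₂ {h c₂} → UValley (c₁ ++ h ∷ c₂) (d₁ ++ d₂) →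
             All (last₀ (d₁ ++ d₂) <_) c₁ → h ≤ last₀ (d₁ ++ d₂) →
             All (_< h) d₁ → All (h ≤_) d₂ → Peeled (c₁ ++ h ∷ c₂) (d₁ ++ d₂)
  peel-cut [] _ _ (_ , d<h) _ h≤d _ _ = contradiction h≤d (<⇒≱ d<h)
  peel-cut (x ∷ a) d₁ [] (v , _) _ h≤d below _ =
    contradiction h≤d (<⇒≱ (All-last₀ (nonEmptyʳ v) (All.++⁺ below [])))
  peel-cut (x ∷ a) [] (y ∷ b) (v , _) _ _ _ (h≤y ∷ _) =
    contradiction (<-≤-trans (subst (y <_) (last₀-++ (x ∷ a) tt) (descent v))
                             (last₀≤head₀ (nonIncr-++⁻ʳ (x ∷ a) (nonIncrˡ v)) tt))
                  (≤⇒≯ h≤y)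
  peel-cut (x ∷ a) (z ∷ e) (y ∷ b) (v , _) above _ below (h≤y ∷ _) =
    inner (mkValley (nonIncr-++⁻ˡ (x ∷ a) (nonIncrˡ v)) (nonDecr-++⁻ʳ (z ∷ e) (nonDecrʳ v)) tt tt
                    (≤-<-trans (head₀≤last₀ (nonDecr-++⁻ʳ (z ∷ e) (nonDecrʳ v)) tt) l<a) , l<a)
          (mkValley (nonIncr-++⁻ʳ (x ∷ a) (nonIncrˡ v)) (nonDecr-++⁻ˡ (z ∷ e) (nonDecrʳ v)) tt tt
                    (subst (z <_) (last₀-++ (x ∷ a) tt) (descent v)) , All-last₀ tt below)
          h≤y
    where
    l<a : last₀ (y ∷ b) < last₀ (x ∷ a)
    l<a = subst (_< last₀ (x ∷ a)) (last₀-++ (z ∷ e) tt) (All-last₀ tt above)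

Nest-exists : ∀ n → length c < n → UValley c d → ∃ (Nest c d)
Nest-exists (suc n) c<n u with peel u
... | outer v = _ , single v
... | inner {a} {b} v u′ le =
  let ws , N = Nest-exists n c′<n u′ in (a ++ b) ∷ ws , nest v N le
  where
  c′<n = <-≤-trans (length-<-++ (nonEmptyˡ (proj₁ v))) (≤-pred c<n)

-- The fuel bounds the nesting depth, which is at most the length of c.
unnest  : ℕ → Word → Word → List Word
peelOff : ℕ → Word → Word → Word → List Word

unnest zero c d = (c ++ d) ∷ []
unnest (suc n) c d = peelOff n (takeWhile (last₀ d <?_) c) (dropWhile (last₀ d <?_) c) d

peelOff n a [] d = (a ++ d) ∷ []
peelOff n a (h ∷ c) d = (a ++ dropWhile (_<? h) d) ∷ unnest n (h ∷ c) (takeWhile (_<? h) d)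

unnest-Nest : ∀ {n} → Nest c d ws → length ws ≤ n → unnest n c d ≡ ws
unnest-Nest {n = suc n} (single {a} {b} v) _ =
  cong₂ (λ a′ c′ → peelOff n a′ c′ b)
        (All.all⇒takeWhile≗id (last₀ b <?_) (VValley-above v))
        (All.all⇒dropWhile≡[] (last₀ b <?_) (VValley-above v))
unnest-Nest (nest {c = []} _ N _) _ = ⊥-elim (nonEmptyˡ (proj₁ (Nest⇒UValley N)))
unnest-Nest {n = suc n} (nest {a} {y ∷ b} {h ∷ c} {d} {ws} v N h≤y) (s≤s ws≤n) = begin
  unnest (suc n) (a ++ h ∷ c) (d ++ y ∷ b)
    ≡⟨ cong₂ (λ a′ c′ → peelOff n a′ c′ (d ++ y ∷ b))
             (takeWhile-++-∷ (last₀ (d ++ y ∷ b) <?_) a-above h-not-above)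
             (dropWhile-++-∷ (last₀ (d ++ y ∷ b) <?_) a-above h-not-above) ⟩
  peelOff n a (h ∷ c) (d ++ y ∷ b)
    ≡⟨ cong₂ (λ b′ d′ → (a ++ b′) ∷ unnest n (h ∷ c) d′)
             (dropWhile-++-∷ (_<? h) d-below (≤⇒≯ h≤y))
             (takeWhile-++-∷ (_<? h) d-below (≤⇒≯ h≤y)) ⟩
  (a ++ y ∷ b) ∷ unnest n (h ∷ c) d
    ≡⟨ cong ((a ++ y ∷ b) ∷_) (unnest-Nest N ws≤n) ⟩
  (a ++ y ∷ b) ∷ ws ∎
  where
  open ≡-Reasoning
  last≡ : last₀ (d ++ y ∷ b) ≡ last₀ (y ∷ b)
  last≡ = last₀-++ d tt
  a-above : All (last₀ (d ++ y ∷ b) <_) a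
  a-above = subst (λ l → All (l <_) a) (sym last≡) (VValley-above v)
  h-not-above : ¬ last₀ (d ++ y ∷ b) < h
  h-not-above =
    ≤⇒≯ (subst (h ≤_) (sym last≡) (≤-trans h≤y (head₀≤last₀ (nonDecrʳ (proj₁ v)) tt)))
  d-below : All (_< h) d
  d-below = UValley-below (Nest⇒UValley N)

unnestWord : Word → List Word
unnestWord w = let c , d = splitValley w in unnest (length w) c d

unnestWord-Nest : Nest c d ws → unnestWord (c ++ d) ≡ ws
unnestWord-Nest {c} N rewrite splitValley-++ (proj₁ (Nest⇒UValley N)) =
  unnest-Nest N (≤-trans (Nest-length N) (length-++-≤ˡ c))

insert : Word → List Word → List Word
insert v [] = v ∷ []
insert v (u ∷ us) =
  let a , b = splitValley v in
  if does (head₀ u ≤? head₀ b) then (a ++ u ++ b) ∷ us else v ∷ u ∷ us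

insert-nested : Valley a b → head₀ u ≤ head₀ b → insert (a ++ b) (u ∷ us) ≡ (a ++ u ++ b) ∷ us
insert-nested {b = b} {u} v u≤b
  rewrite splitValley-++ v | dec-true (head₀ u ≤? head₀ b) u≤b = refl

insert-apart : Valley a b → head₀ b < head₀ u → insert (a ++ b) (u ∷ us) ≡ (a ++ b) ∷ u ∷ us
insert-apart {b = b} {u} v b<u
  rewrite splitValley-++ v | dec-false (head₀ u ≤? head₀ b) (<⇒≱ b<u) = refl

-- The chain condition rmin < max against the next word: a U-word starts with its maximum.
_<ᴴ_ : ℕ → List Word → Set
m <ᴴ [] = ⊤
m <ᴴ (u ∷ _) = m < head₀ u

insert-Nest : VValley a b → Nest c d ws → head₀ c ≤ head₀ b →
              insert (a ++ b) ((c ++ d) ∷ us) ≡ ((a ++ c) ++ (d ++ b)) ∷ us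
insert-Nest {a} {b} {c} {d} {us = us} v N c≤b =
  trans (insert-nested (proj₁ v) (subst (_≤ head₀ b) (sym (head₀-Nestˡ N)) c≤b))
        (cong (_∷ us) (++-regroup a c d b))

foldr-insert-Nest : Nest c d ws → head₀ d <ᴴ us → foldr insert us ws ≡ (c ++ d) ∷ us
foldr-insert-Nest {us = []} (single _) _ = refl
foldr-insert-Nest {us = _ ∷ _} (single (v , _)) b<u = insert-apart v b<u
foldr-insert-Nest {us = us} (nest {a} {b} {c} {d} {ws} v N c≤b) db<us = begin
  insert (a ++ b) (foldr insert us ws) ≡⟨ cong (insert (a ++ b)) (foldr-insert-Nest N d<us) ⟩
  insert (a ++ b) ((c ++ d) ∷ us)     ≡⟨ insert-Nest v N c≤b ⟩
  ((a ++ c) ++ (d ++ b)) ∷ us         ∎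
  where
  open ≡-Reasoning
  d<us : head₀ d <ᴴ us
  d<us = subst (_<ᴴ us) (head₀-Nestʳ N) db<us

-- Lists of nests

data Nests : List Word → List Word → Set where
  []   : Nests [] []
  cons : Nest c d ws → head₀ d <ᴴ us → Nests us vs → Nests ((c ++ d) ∷ us) (ws ++ vs)

insert-Nests : VValley a b → Nests us vs → Nests (insert (a ++ b) us) ((a ++ b) ∷ vs)
insert-Nests v [] = cons (single v) tt []
insert-Nests {a} {b} v (cons {c} {d} {us = us} N d<us Ns) with head₀ c ≤? head₀ b
... | yes c≤b =
  subst (λ us′ → Nests us′ _) (sym (insert-Nest v N c≤b))
        (cons (nest v N c≤b) (subst (_<ᴴ us) (sym (head₀-Nestʳ N)) d<us) Ns)
... | no c≰b =
  subst (λ us′ → Nests us′ _) (sym (insert-apart (proj₁ v) b<cd))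
        (cons (single v) b<cd (cons N d<us Ns))
  where
  b<cd : head₀ b < head₀ (c ++ d)
  b<cd = subst (head₀ b <_) (sym (head₀-Nestˡ N)) (≰⇒> c≰b)

nestAll : List Word → List Word
nestAll = foldr insert []

nestAll-Nests : All VWord vs → Nests (nestAll vs) vs
nestAll-Nests [] = []
nestAll-Nests (v ∷ vs) with VWord⇒VValley v
... | _ , _ , refl , vv = insert-Nests vv (nestAll-Nests vs)

Nests⇒nestAll : Nests us vs → nestAll vs ≡ us
Nests⇒nestAll [] = refl
Nests⇒nestAll (cons {c} {d} {ws} {us} {vs} N d<us Ns) = begin
  foldr insert [] (ws ++ vs)           ≡⟨ foldr-++ insert [] ws vs ⟩
  foldr insert (foldr insert [] vs) ws ≡⟨ cong (λ us′ → foldr insert us′ ws) (Nests⇒nestAll Ns) ⟩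
  foldr insert us ws                   ≡⟨ foldr-insert-Nest N d<us ⟩
  (c ++ d) ∷ us                        ∎
  where open ≡-Reasoning

unnestAll : List Word → List Word
unnestAll = concatMap unnestWord

Nests⇒unnestAll : Nests us vs → unnestAll us ≡ vs
Nests⇒unnestAll [] = refl
Nests⇒unnestAll (cons N _ Ns) = cong₂ _++_ (unnestWord-Nest N) (Nests⇒unnestAll Ns)

Chain-tail : Chain (u ∷ us) → Chain us
Chain-tail c[ _ ] = c[]
Chain-tail (c∷ _ ch) = ch

Chain⇒<ᴴ : UValley c d → All UWord us → Chain ((c ++ d) ∷ us) → head₀ d <ᴴ us
Chain⇒<ᴴ _ [] _ = tt
Chain⇒<ᴴ uv (u ∷ _) (c∷ (s , rmin<max) _) =
  subst₂ _<_ (sym (rmin-unique uv s)) (maxL-UWord u) rmin<max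

unnestAll-Nests : All UWord us → Chain us → Nests us (unnestAll us)
unnestAll-Nests [] _ = []
unnestAll-Nests (u ∷ us) ch with UWord⇒UValley u
... | _ , _ , refl , uv , _ with Nest-exists _ ≤-refl uv
...   | _ , N rewrite unnestWord-Nest N =
  cons N (Chain⇒<ᴴ uv us ch) (unnestAll-Nests us (Chain-tail ch))

Nests⇒UWords : Nests us vs → All UWord us
Nests⇒UWords [] = []
Nests⇒UWords (cons N _ Ns) = UValley⇒UWord (Nest⇒UValley N) ∷ Nests⇒UWords Ns

Nests⇒VWords : Nests us vs → All VWord vs
Nests⇒VWords [] = []
Nests⇒VWords (cons N _ Ns) = All.++⁺ (Nest⇒VWords N) (Nests⇒VWords Ns)

Nests⇒Chain : Nests us vs → Chain us
Nests⇒Chain [] = c[]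
Nests⇒Chain (cons _ _ []) = c[ _ ]
Nests⇒Chain (cons N d<u Ns@(cons {c′} {d′} _ _ _)) =
  c∷ (UValley⇒UWord uv , subst (_< maxL (c′ ++ d′)) (sym (rmin-UValley⇒UWord uv))
                                 (<-≤-trans d<u (head₀≤maxL (c′ ++ d′))))
     (Nests⇒Chain Ns)
  where
  uv = Nest⇒UValley N

Nests-↭ : Nests us vs → concat us ↭ concat vs
Nests-↭ [] = ↭-refl
Nests-↭ (cons {ws = ws} {vs = vs} N _ Ns) =
  ↭-trans (↭.++⁺ (Nest-↭ N) (Nests-↭ Ns)) (↭-reflexive (concat-++ ws vs))

Nests-length : Nests us vs → sum (map length us) ≡ sum (map length vs)
Nests-length {us} {vs} N = sum-length-↭ us vs (Nests-↭ N)

Nests-dec : Nests us vs → sum (map dec us) ≡ sum (map dec vs)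
Nests-dec [] = refl
Nests-dec (cons {c} {d} {ws} {us} {vs} N _ Ns) = begin
  dec (c ++ d) + sum (map dec us)
    ≡⟨ cong (_+ sum (map dec us)) (dec-Valley (proj₁ (Nest⇒UValley N))) ⟩
  length c + sum (map dec us)
    ≡⟨ cong₂ _+_ (sym (Nest-dec N)) (Nests-dec Ns) ⟩
  sum (map dec ws) + sum (map dec vs)
    ≡⟨ sym (sum-++ (map dec ws) (map dec vs)) ⟩
  sum (map dec ws ++ map dec vs)
    ≡⟨ cong sum (sym (map-++ dec ws vs)) ⟩
  sum (map dec (ws ++ vs)) ∎
  where open ≡-Reasoning

proposition3p2 : (r n : ℕ) →
    Σ (Seq → Seq) λ φ → Σ (Seq → Seq) λ ψ →
      ((s : Seq) → InV r n s → InU r n (φ s) × ψ (φ s) ≡ s × Compatible s (φ s)) ×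
      ((t : Seq) → InU r n t → InV r n (ψ t) × φ (ψ t) ≡ t)
proposition3p2 r n = φ , ψ , φ-correct , ψ-correct
  where
  φ ψ : Seq → Seq
  φ (w₀ , vs) = w₀ , nestAll vs
  ψ (w₀ , us) = w₀ , unnestAll us

  φ-correct : (s : Seq) → InV r n s → InU r n (φ s) × ψ (φ s) ≡ s × Compatible s (φ s)
  φ-correct (w₀ , vs) (ni , bd , vs-ok , total) =
    (ni , bd ,
     All.zip (Nests⇒UWords N , All-concat-↭ (↭-sym (Nests-↭ N)) (proj₂ (All.unzip vs-ok))) ,
     Nests⇒Chain N , trans (cong (length w₀ +_) (Nests-length N)) total) ,
    cong (w₀ ,_) (Nests⇒unnestAll N) , refl , Nests-↭ N , Nests-dec N
    where
    N = nestAll-Nests (proj₁ (All.unzip vs-ok))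

  ψ-correct : (t : Seq) → InU r n t → InV r n (ψ t) × φ (ψ t) ≡ t
  ψ-correct (w₀ , us) (ni , bd , us-ok , chain , total) =
    (ni , bd ,
     All.zip (Nests⇒VWords N , All-concat-↭ (Nests-↭ N) (proj₂ (All.unzip us-ok))) ,
     trans (cong (length w₀ +_) (sym (Nests-length N))) total) ,
    cong (w₀ ,_) (Nests⇒nestAll N)
    where
    N = unnestAll-Nests (proj₁ (All.unzip us-ok)) chain
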